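{- For each integer $r\ge 3$ there exists a constant $c>0$ such that for every integer $t\ge 2$ there is a finite graph $G$ with $\Delta(G)=r$ and $\tau_t(G)\ge c\,t^2/\lg t$.
   Context: $\lg$ denotes logarithm base 2. For a positive integer $t$, a $t$-tone $k$-coloring of a graph $G$ is a function $f:V(G)\to\binom{[k]}{t}$ (assigning to each vertex a $t$-element subset of $[k]=\{1,\dots,k\}$) such that $|f(u)\cap f(v)|<d(u,v)$ for all distinct vertices $u,v$, where $d(u,v)$ is the graph distance. $\tau_t(G)$ is the minimum $k$ such that $G$ has a $t$-tone $k$-coloring. -}

module Defs where

open import Data.Nat using (ℕ; zero; suc; _+_; _*_; _^_; _≤_; _<_)
open import Data.Bool using (Bool; true; false; if_then_else_)
open import Data.Fin using (Fin)
open import Data.Fin.Subset using (Subset; _∩_; ∣_∣)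
open import Data.List using (List; allFin; length; filter)
open import Data.Product using (Σ; _×_; ∃; ∃-syntax)
open import Relation.Binary.PropositionalEquality using (_≡_; _≢_)
open import Relation.Nullary using (¬_)
open import Data.Bool.Properties using (T?)
open import Data.Bool using (T)

record Graph : Set where
  field
    n     : ℕ
    adj   : Fin n → Fin n → Bool
    sym   : ∀ u v → adj u v ≡ adj v u
    irref : ∀ v → adj v v ≡ false
open Graph public

degree : (G : Graph) → Fin (n G) → ℕ
degree G v = length (filter (λ w → T? (adj G v w)) (allFin (n G)))

MaxDegreeIs : Graph → ℕ → Set
MaxDegreeIs G r = (∀ v → degree G v ≤ r) × (∃[ v ] degree G v ≡ r)

data Walk (G : Graph) : Fin (n G) → Fin (n G) → ℕ → Set where
  here : ∀ {u} → Walk G u u 0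
  step : ∀ {u w v m} → adj G u w ≡ true → Walk G w v m → Walk G u v (suc m)

DistLe : (G : Graph) → Fin (n G) → Fin (n G) → ℕ → Set
DistLe G u v m = ∃[ ℓ ] (ℓ ≤ m × Walk G u v ℓ)

-- m < d(u,v)  (d(u,v) = ∞ when u,v are in different components)
LtDist : (G : Graph) → ℕ → Fin (n G) → Fin (n G) → Set
LtDist G m u v = ¬ DistLe G u v m

record ToneColoring (G : Graph) (t k : ℕ) : Set where
  field
    col     : Fin (n G) → Subset k
    size    : ∀ v → ∣ col v ∣ ≡ t
    spread  : ∀ u v → u ≢ v → LtDist G ∣ col u ∩ col v ∣ u v

-- τ_t(G) ≥ bound is expressed as: every k admitting a t-tone k-coloring
-- satisfies the bound (τ_t(G) is the least such k; one always exists).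

module Submission where

-- The witness graph G(t,r) is the disjoint union of the heap-ordered binary tree on the
-- vertices 1, …, t (the parent of j ≥ 2 is ⌊j/2⌋) and a star with hub t+1 and r leaves.
-- Tree vertices have degree ≤ 3 ≤ r, leaves degree 1 and the hub degree exactly r, so
-- Δ(G) = r.  If 2^L ≤ t < 2^(L+1), every tree vertex is within L steps of the root 1, so
-- two tree vertices are at distance ≤ 2L and, in a t-tone k-colouring, their colour sets
-- share at most 2L colours.  A Bonferroni-type estimate then shows that the first j colour
-- sets cover at least j·t − 2L·j² colours; with j = ⌊t/4L⌋ this yields t² ≤ 12·L·k, and
-- since 2^L ≤ t we get 2^(t²) ≤ t^(12k).  Hence the theorem holds with c = p/q = 1/12.

open import Defs hiding (sym)
open import Data.Nat using (ℕ; zero; suc; _+_; _∸_; _*_; _^_; _≤_; _<_; z≤n; s≤s; _≟_; _≤?_; _<?_; NonZero; >-nonZero)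
open import Data.Nat.Properties hiding (_≟_; _≤?_; _<?_)
open import Data.Nat.DivMod using (_/_; _%_; _mod_; m%n<n; m<n⇒m%n≡m; m/n≤m; m/n<m; m/n*n≤m; m≥n⇒m/n>0; m<n*o⇒m/o<n; m≡m%n+[m/n]*n)
open import Data.Nat.Tactic.RingSolver using (solve-∀)
open import Data.Bool using (Bool; true; false)
open import Data.Vec using ([]; _∷_)
open import Data.Bool.Properties using (T?)
open import Data.Fin using (Fin; toℕ) renaming (zero to fzero; suc to fsuc)
open import Data.Fin.Properties using (toℕ-fromℕ<)
open import Data.Fin.Subset using (Subset; _∩_; _∪_; ∣_∣; ⊥)
open import Data.Fin.Subset.Properties using (∣p∣≤n; ∣⊥∣≡0; ∩-zeroˡ; ∩-distribʳ-∪)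
open import Data.List using (filter; length; tabulate)
open import Data.Product using (_×_; _,_; ∃-syntax)
open import Data.Sum using (_⊎_; inj₁; inj₂)
open import Function.Bundles using (mk⇔)
open import Relation.Nullary using (¬_; Dec; yes; no; does; contradiction)
open import Relation.Nullary.Decidable using (_×-dec_; _⊎-dec_; dec-true; dec-false; does-⇔)
open import Relation.Unary using (Decidable)
open import Relation.Binary.PropositionalEquality using (_≡_; _≢_; refl; sym; trans; cong; subst; subst₂)

open ToneColoring using (col; size; spread)

module _ {G : Graph} where

  walk-snoc : ∀ {u w v a} → Walk G u w a → adj G w v ≡ true → Walk G u v (suc a)
  walk-snoc here         e = step e here
  walk-snoc (step e′ p) e = step e′ (walk-snoc p e)

  walk-reverse : ∀ {u v a} → Walk G u v a → Walk G v u a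
  walk-reverse here                 = here
  walk-reverse (step {u} {w} e p) = walk-snoc (walk-reverse p) (trans (Graph.sym G w u) e)

  walk-append : ∀ {u w v a b} → Walk G u w a → Walk G w v b → Walk G u v (a + b)
  walk-append here       q = q
  walk-append (step e p) q = step e (walk-append p q)

  dist-refl : ∀ {u} m → DistLe G u u m
  dist-refl m = 0 , z≤n , here

  dist-step : ∀ {u w v m} → adj G u w ≡ true → DistLe G w v m → DistLe G u v (suc m)
  dist-step e (ℓ , ℓ≤m , p) = suc ℓ , s≤s ℓ≤m , step e p

  dist-sym : ∀ {u v m} → DistLe G u v m → DistLe G v u m
  dist-sym (ℓ , ℓ≤m , p) = ℓ , ℓ≤m , walk-reverse p

  dist-trans : ∀ {u w v a b} → DistLe G u w a → DistLe G w v b → DistLe G u v (a + b)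
  dist-trans (ℓ , ℓ≤a , p) (ℓ′ , ℓ′≤b , q) = ℓ + ℓ′ , +-mono-≤ ℓ≤a ℓ′≤b , walk-append p q

  dist-mono : ∀ {u v m m′} → m ≤ m′ → DistLe G u v m → DistLe G u v m′
  dist-mono m≤m′ (ℓ , ℓ≤m , p) = ℓ , ≤-trans ℓ≤m m≤m′ , p

shared≤distance : ∀ {G t k} (f : ToneColoring G t k) {u v m} →
  u ≢ v → DistLe G u v m → ∣ col f u ∩ col f v ∣ ≤ m
shared≤distance f u≢v d = ≮⇒≥ (λ m<shared → spread f _ _ u≢v (dist-mono (<⇒≤ m<shared) d))

indicator : ∀ {A : Set} → Dec A → ℕ
indicator (yes _) = 1
indicator (no _)  = 0

count : ∀ {Q : ℕ → Set} → Decidable Q → ℕ → ℕ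
count Q? zero    = 0
count Q? (suc m) = indicator (Q? 0) + count (λ x → Q? (suc x)) m

count-none : ∀ {Q : ℕ → Set} (Q? : Decidable Q) → (∀ x → ¬ Q x) → ∀ m → count Q? m ≡ 0
count-none Q? none zero = refl
count-none Q? none (suc m) with Q? 0
... | yes q = contradiction q (none 0)
... | no _  = count-none (λ x → Q? (suc x)) (λ x → none (suc x)) m

count-unique : ∀ {Q : ℕ → Set} (Q? : Decidable Q) → (∀ {x y} → Q x → Q y → x ≡ y) → ∀ m → count Q? m ≤ 1
count-unique Q? unique zero = z≤n
count-unique Q? unique (suc m) with Q? 0
... | yes q = s≤s (≤-reflexive (count-none (λ x → Q? (suc x)) (λ x q′ → 0≢1+n (unique q q′)) m))
... | no _  = count-unique (λ x → Q? (suc x)) (λ q q′ → suc-injective (unique q q′)) m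

count-⊎ : ∀ {Q R S : ℕ → Set} (Q? : Decidable Q) (R? : Decidable R) (S? : Decidable S) →
  (∀ x → Q x → R x ⊎ S x) → ∀ m → count Q? m ≤ count R? m + count S? m
count-⊎ Q? R? S? cover zero    = z≤n
count-⊎ {Q} {R} {S} Q? R? S? cover (suc m) = begin
    indicator (Q? 0) + count Q?′ m
  ≤⟨ +-mono-≤ (head (cover 0) (Q? 0) (R? 0) (S? 0)) (count-⊎ Q?′ R?′ S?′ (λ x → cover (suc x)) m) ⟩
    (indicator (R? 0) + indicator (S? 0)) + (count R?′ m + count S?′ m)
  ≡⟨ interchange (indicator (R? 0)) (indicator (S? 0)) (count R?′ m) (count S?′ m) ⟩
    (indicator (R? 0) + count R?′ m) + (indicator (S? 0) + count S?′ m)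
  ∎
  where
    open ≤-Reasoning
    Q?′ : Decidable (λ x → Q (suc x))
    Q?′ x = Q? (suc x)
    R?′ : Decidable (λ x → R (suc x))
    R?′ x = R? (suc x)
    S?′ : Decidable (λ x → S (suc x))
    S?′ x = S? (suc x)
    interchange : ∀ a b c d → (a + b) + (c + d) ≡ (a + c) + (b + d)
    interchange = solve-∀
    head : ∀ {A B C : Set} → (A → B ⊎ C) → (a : Dec A) (b : Dec B) (c : Dec C) →
      indicator a ≤ indicator b + indicator c
    head cov (no _)  b       c       = z≤n
    head cov (yes _) (yes _) c       = s≤s z≤n
    head cov (yes _) (no _)  (yes _) = s≤s z≤n
    head cov (yes a) (no ¬b) (no ¬c) with cov a
    ... | inj₁ b = contradiction b ¬b
    ... | inj₂ c = contradiction c ¬c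

count-from : ∀ {Q : ℕ → Set} (Q? : Decidable Q) (lo : ℕ) →
  (∀ x → Q x → lo ≤ x) → (∀ x → lo ≤ x → Q x) → ∀ m → count Q? m ≡ m ∸ lo
count-from Q? lo       sound complete zero = sym (0∸n≡0 lo)
count-from Q? zero     sound complete (suc m) with Q? 0
... | yes _ = cong suc (count-from (λ x → Q? (suc x)) 0 (λ _ _ → z≤n) (λ x _ → complete (suc x) z≤n) m)
... | no ¬q = contradiction (complete 0 z≤n) ¬q
count-from Q? (suc lo) sound complete (suc m) with Q? 0
... | yes q = contradiction (sound 0 q) λ ()
... | no _  = count-from (λ x → Q? (suc x)) lo
                  (λ x q → ≤-pred (sound (suc x) q)) (λ x lo≤x → complete (suc x) (s≤s lo≤x)) m

filter-count : ∀ {A : Set} {Q : ℕ → Set} {m} (b : A → Bool) (f : Fin m → A) (Q? : Decidable Q) →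
  (∀ i → b (f i) ≡ does (Q? (toℕ i))) → length (filter (λ x → T? (b x)) (tabulate f)) ≡ count Q? m
filter-count {m = zero}  b f Q? agree = refl
filter-count {m = suc m} b f Q? agree rewrite agree fzero with Q? 0
... | yes _ = cong suc (filter-count b (λ i → f (fsuc i)) (λ x → Q? (suc x)) (λ i → agree (fsuc i)))
... | no _  = filter-count b (λ i → f (fsuc i)) (λ x → Q? (suc x)) (λ i → agree (fsuc i))

degree-count : ∀ (G : Graph) (v : Fin (n G)) {Q : ℕ → Set} (Q? : Decidable Q) →
  (∀ w → adj G v w ≡ does (Q? (toℕ w))) → degree G v ≡ count Q? (n G)
degree-count G v Q? agree = filter-count (adj G v) (λ w → w) Q? agree

halving : ∀ j → j ≡ j / 2 * 2 ⊎ j ≡ suc (j / 2 * 2)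
halving j with j % 2 | m%n<n j 2 | m≡m%n+[m/n]*n j 2
... | 0     | _                 | j≡ = inj₁ j≡
... | 1     | _                 | j≡ = inj₂ j≡
... | suc (suc _) | s≤s (s≤s ()) | _

-- The graph G(t,r) on the vertices 0, …, t+r+1: the heap tree on 1, …, t, the star with
-- hub t+1 and leaves t+2, …, t+r+1, and the isolated vertex 0.
module HeapAndStar (t r : ℕ) where

  hub : ℕ
  hub = suc t

  order : ℕ
  order = suc (suc (t + r))

  IsParent : ℕ → ℕ → Set
  IsParent p j = (2 ≤ j × j ≤ t × p ≡ j / 2) ⊎ (hub < j × p ≡ hub)

  isParent? : ∀ p j → Dec (IsParent p j)
  isParent? p j = (2 ≤? j ×-dec j ≤? t ×-dec p ≟ j / 2) ⊎-dec (hub <? j ×-dec p ≟ hub)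

  Adjacent : ℕ → ℕ → Set
  Adjacent i j = IsParent i j ⊎ IsParent j i

  adjacent? : ∀ i j → Dec (Adjacent i j)
  adjacent? i j = isParent? i j ⊎-dec isParent? j i

  adjacent-sym : ∀ {i j} → Adjacent i j → Adjacent j i
  adjacent-sym (inj₁ p) = inj₂ p
  adjacent-sym (inj₂ p) = inj₁ p

  -- nobody is its own parent: j / 2 < j for j ≥ 2, and leaves lie above the hub
  not-own-parent : ∀ {i} → ¬ IsParent i i
  not-own-parent {i} (inj₁ (2≤i , _ , i≡i/2)) =
    <-irrefl (sym i≡i/2) (m/n<m i 2 {{>-nonZero (≤-trans (s≤s z≤n) 2≤i)}} (s≤s (s≤s z≤n)))
  not-own-parent (inj₂ (hub<i , i≡hub)) = <-irrefl (sym i≡hub) hub<i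

  not-self-adjacent : ∀ {i} → ¬ Adjacent i i
  not-self-adjacent (inj₁ p) = not-own-parent p
  not-self-adjacent (inj₂ p) = not-own-parent p

  graph : Graph
  graph = record
    { n     = order
    ; adj   = λ u v → does (adjacent? (toℕ u) (toℕ v))
    ; sym   = λ u v → does-⇔ (mk⇔ adjacent-sym adjacent-sym)
                               (adjacent? (toℕ u) (toℕ v)) (adjacent? (toℕ v) (toℕ u))
    ; irref = λ v → dec-false (adjacent? (toℕ v) (toℕ v)) not-self-adjacent
    }

  vertex : ℕ → Fin order
  vertex i = i mod order

  toℕ-vertex : ∀ {i} → i < order → toℕ (vertex i) ≡ i
  toℕ-vertex i<order = trans (toℕ-fromℕ< _) (m<n⇒m%n≡m i<order)

  hub<order : hub < order
  hub<order = s≤s (s≤s (m≤m+n t r))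

  tree-vertex<order : ∀ {j} → j ≤ t → j < order
  tree-vertex<order j≤t = ≤-trans (s≤s j≤t) (<⇒≤ hub<order)

  -- A vertex other than the hub has at most one parent and at most two children (2i and
  -- 2i+1), so its degree is at most 3.
  parent-unique : ∀ {p p′ j} → IsParent p j → IsParent p′ j → p ≡ p′
  parent-unique (inj₁ (_ , _ , p≡)) (inj₁ (_ , _ , p′≡)) = trans p≡ (sym p′≡)
  parent-unique (inj₂ (_ , p≡))     (inj₂ (_ , p′≡))     = trans p≡ (sym p′≡)
  parent-unique (inj₁ (_ , j≤t , _)) (inj₂ (hub<j , _))  = contradiction (<-trans (n<1+n t) hub<j) (≤⇒≯ j≤t)
  parent-unique (inj₂ (hub<j , _))  (inj₁ (_ , j≤t , _)) = contradiction (<-trans (n<1+n t) hub<j) (≤⇒≯ j≤t)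

  children-off-hub : ∀ {i j} → i ≢ hub → IsParent i j → j ≡ i * 2 ⊎ j ≡ suc (i * 2)
  children-off-hub i≢hub (inj₁ (_ , _ , refl)) = halving _
  children-off-hub i≢hub (inj₂ (_ , i≡hub))    = contradiction i≡hub i≢hub

  degree-off-hub : ∀ {i} → i ≢ hub → count (adjacent? i) order ≤ 3
  degree-off-hub {i} i≢hub = begin
      count (adjacent? i) order
    ≤⟨ count-⊎ (adjacent? i) (isParent? i) (λ j → isParent? j i) (λ _ a → a) order ⟩
      count (isParent? i) order + count (λ j → isParent? j i) order
    ≤⟨ +-mono-≤ children≤2 (count-unique (λ j → isParent? j i) parent-unique order) ⟩
      2 + 1
    ∎
    where
      open ≤-Reasoning
      children≤2 : count (isParent? i) order ≤ 2
      children≤2 = begin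
          count (isParent? i) order
        ≤⟨ count-⊎ (isParent? i) (λ j → j ≟ i * 2) (λ j → j ≟ suc (i * 2))
                   (λ _ → children-off-hub i≢hub) order ⟩
          count (λ j → j ≟ i * 2) order + count (λ j → j ≟ suc (i * 2)) order
        ≤⟨ +-mono-≤ (count-unique (λ j → j ≟ i * 2) (λ x y → trans x (sym y)) order)
                    (count-unique (λ j → j ≟ suc (i * 2)) (λ x y → trans x (sym y)) order) ⟩
          1 + 1
        ∎

  hub-adjacent : ∀ {j} → Adjacent hub j → hub < j
  hub-adjacent (inj₁ (inj₁ (_ , j≤t , hub≡j/2))) =
    contradiction (≤-trans (≤-reflexive hub≡j/2) (≤-trans (m/n≤m _ 2) j≤t)) (n≮n t)
  hub-adjacent (inj₁ (inj₂ (hub<j , _))) = hub<j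
  hub-adjacent (inj₂ (inj₁ (_ , hub≤t , _))) = contradiction hub≤t (n≮n t)
  hub-adjacent (inj₂ (inj₂ (hub<hub , _))) = contradiction hub<hub (n≮n hub)

  hub-count : count (adjacent? hub) order ≡ r
  hub-count = trans (count-from (adjacent? hub) (suc hub) (λ _ → hub-adjacent)
                                (λ _ hub<j → inj₁ (inj₂ (hub<j , refl))) order)
                    (m+n∸m≡n t r)

  degree-is-count : ∀ v → degree graph v ≡ count (adjacent? (toℕ v)) order
  degree-is-count v = degree-count graph v (adjacent? (toℕ v)) (λ _ → refl)

  degree-of-hub : ∀ {v} → toℕ v ≡ hub → degree graph v ≡ r
  degree-of-hub {v} v≡hub =
    trans (degree-is-count v) (trans (cong (λ i → count (adjacent? i) order) v≡hub) hub-count)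

  max-degree : 3 ≤ r → MaxDegreeIs graph r
  max-degree 3≤r = bounded , vertex hub , attained
    where
      bounded : ∀ v → degree graph v ≤ r
      bounded v with toℕ v ≟ hub
      ... | yes v≡hub = ≤-reflexive (degree-of-hub v≡hub)
      ... | no v≢hub  = ≤-trans (≤-reflexive (degree-is-count v)) (≤-trans (degree-off-hub v≢hub) 3≤r)
      attained : degree graph (vertex hub) ≡ r
      attained = degree-of-hub (toℕ-vertex hub<order)

  parent-edge : ∀ {j} → 2 ≤ j → j ≤ t → adj graph (vertex j) (vertex (j / 2)) ≡ true
  parent-edge {j} 2≤j j≤t = dec-true (adjacent? _ _)
    (subst₂ Adjacent (sym (toℕ-vertex (tree-vertex<order j≤t)))
                     (sym (toℕ-vertex (tree-vertex<order (≤-trans (m/n≤m j 2) j≤t))))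
                     (inj₂ (inj₁ (2≤j , j≤t , refl))))

  near-root : ∀ L j → 1 ≤ j → j ≤ t → j < 2 ^ suc L → DistLe graph (vertex j) (vertex 1) L
  near-root L       1                 _ _   _     = dist-refl L
  near-root zero    (suc (suc j))     _ _   (s≤s (s≤s ()))
  near-root (suc L) j@(suc (suc _))   _ j≤t j<2^L+2 =
    dist-step (parent-edge 2≤j j≤t)
      (near-root L (j / 2) (m≥n⇒m/n>0 2≤j) (≤-trans (m/n≤m j 2) j≤t)
        (m<n*o⇒m/o<n (subst (j <_) (*-comm 2 (2 ^ suc L)) j<2^L+2)))
    where
      2≤j : 2 ≤ j
      2≤j = s≤s (s≤s z≤n)

  tree-distance : ∀ {L i j} → t < 2 ^ suc L → 1 ≤ i → i ≤ t → 1 ≤ j → j ≤ t →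
    DistLe graph (vertex i) (vertex j) (L + L)
  tree-distance {L} t<2^L+1 1≤i i≤t 1≤j j≤t =
    dist-trans (near-root L _ 1≤i i≤t (≤-<-trans i≤t t<2^L+1))
               (dist-sym (near-root L _ 1≤j j≤t (≤-<-trans j≤t t<2^L+1)))

∣∪∣+∣∩∣ : ∀ {k} (p q : Subset k) → ∣ p ∪ q ∣ + ∣ p ∩ q ∣ ≡ ∣ p ∣ + ∣ q ∣
∣∪∣+∣∩∣ []           []           = refl
∣∪∣+∣∩∣ (true ∷ p)  (true ∷ q)  = cong suc (trans (+-suc _ _) (trans (cong suc (∣∪∣+∣∩∣ p q)) (sym (+-suc _ _))))
∣∪∣+∣∩∣ (true ∷ p)  (false ∷ q) = cong suc (∣∪∣+∣∩∣ p q)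
∣∪∣+∣∩∣ (false ∷ p) (true ∷ q)  = trans (cong suc (∣∪∣+∣∩∣ p q)) (sym (+-suc _ _))
∣∪∣+∣∩∣ (false ∷ p) (false ∷ q) = ∣∪∣+∣∩∣ p q

∣∪∣≤ : ∀ {k} (p q : Subset k) → ∣ p ∪ q ∣ ≤ ∣ p ∣ + ∣ q ∣
∣∪∣≤ p q = m+n≤o⇒m≤o ∣ p ∪ q ∣ (≤-reflexive (∣∪∣+∣∩∣ p q))

⋃< : ∀ {k} → (ℕ → Subset k) → ℕ → Subset k
⋃< C zero    = ⊥
⋃< C (suc j) = ⋃< C j ∪ C j

∣⋃<∩∣≤ : ∀ {k s} (C : ℕ → Subset k) (A : Subset k) j → (∀ i → i < j → ∣ C i ∩ A ∣ ≤ s) →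
  ∣ ⋃< C j ∩ A ∣ ≤ j * s
∣⋃<∩∣≤ {k} C A zero small = ≤-reflexive (trans (cong ∣_∣ (∩-zeroˡ A)) (∣⊥∣≡0 k))
∣⋃<∩∣≤ {s = s} C A (suc j) small = begin
    ∣ (⋃< C j ∪ C j) ∩ A ∣                 ≡⟨ cong ∣_∣ (∩-distribʳ-∪ A (⋃< C j) (C j)) ⟩
    ∣ (⋃< C j ∩ A) ∪ (C j ∩ A) ∣           ≤⟨ ∣∪∣≤ (⋃< C j ∩ A) (C j ∩ A) ⟩
    ∣ ⋃< C j ∩ A ∣ + ∣ C j ∩ A ∣            ≤⟨ +-mono-≤ (∣⋃<∩∣≤ C A j (λ i i<j → small i (m≤n⇒m≤1+n i<j)))
                                                          (small j ≤-refl) ⟩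
    j * s + s                               ≡⟨ +-comm (j * s) s ⟩
    suc j * s                               ∎
  where open ≤-Reasoning

union-estimate : ∀ {k t s} (C : ℕ → Subset k) → (∀ i → ∣ C i ∣ ≡ t) → ∀ j →
  (∀ i i′ → i < j → i′ < j → i ≢ i′ → ∣ C i ∩ C i′ ∣ ≤ s) →
  j * t ≤ ∣ ⋃< C j ∣ + s * (j * j)
union-estimate C sizes zero    overlaps = z≤n
union-estimate {t = t} {s} C sizes (suc j) overlaps = begin
    t + j * t
  ≤⟨ +-monoʳ-≤ t previous ⟩
    t + (∣ U ∣ + s * (j * j))
  ≡⟨ regroup t ∣ U ∣ (s * (j * j)) ⟩
    (∣ U ∣ + t) + s * (j * j)
  ≡⟨ cong (_+ s * (j * j)) covered ⟨
    (∣ U ∪ C j ∣ + ∣ U ∩ C j ∣) + s * (j * j)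
  ≤⟨ +-monoˡ-≤ (s * (j * j)) (+-monoʳ-≤ ∣ U ∪ C j ∣ new-overlap) ⟩
    (∣ U ∪ C j ∣ + j * s) + s * (j * j)
  ≤⟨ m≤m+n _ (j * s + s) ⟩
    (∣ U ∪ C j ∣ + j * s) + s * (j * j) + (j * s + s)
  ≡⟨ square ∣ U ∪ C j ∣ j s ⟩
    ∣ U ∪ C j ∣ + s * (suc j * suc j)
  ∎
  where
    open ≤-Reasoning
    U : Subset _
    U = ⋃< C j
    previous : j * t ≤ ∣ U ∣ + s * (j * j)
    previous = union-estimate C sizes j
      (λ i i′ i<j i′<j → overlaps i i′ (m≤n⇒m≤1+n i<j) (m≤n⇒m≤1+n i′<j))
    covered : ∣ U ∪ C j ∣ + ∣ U ∩ C j ∣ ≡ ∣ U ∣ + t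
    covered = trans (∣∪∣+∣∩∣ U (C j)) (cong (∣ U ∣ +_) (sizes j))
    new-overlap : ∣ U ∩ C j ∣ ≤ j * s
    new-overlap = ∣⋃<∩∣≤ C (C j) j (λ i i<j → overlaps i j (m≤n⇒m≤1+n i<j) ≤-refl (<⇒≢ i<j))
    regroup : ∀ a b c → a + (b + c) ≡ (b + a) + c
    regroup = solve-∀
    square : ∀ x j s → (x + j * s) + s * (j * j) + (j * s + s) ≡ x + s * ((1 + j) * (1 + j))
    square = solve-∀

-- With d = 4L and j·d ≤ t < d + j·d (i.e. j = ⌊t/d⌋), the union estimate
-- j·t ≤ k + 2L·j² first forces j·t ≤ 2k (as 2L·j² ≤ j·t/2) and then t² ≤ 12·L·k.
balance : ∀ {t k L j} → t ≤ k → j * t ≤ k + (L + L) * (j * j) →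
  j * (4 * L) ≤ t → t < 4 * L + j * (4 * L) → t * t ≤ L * (12 * k)
balance {t} {k} {L} {j} t≤k estimate jd≤t t<d+jd = begin
    t * t                            ≤⟨ *-monoʳ-≤ t (<⇒≤ t<d+jd) ⟩
    t * (4 * L + j * (4 * L))        ≡⟨ expand t L j ⟩
    4 * L * t + 4 * L * (j * t)      ≤⟨ +-mono-≤ (*-monoʳ-≤ (4 * L) t≤k) (*-monoʳ-≤ (4 * L) jt≤2k) ⟩
    4 * L * k + 4 * L * (k + k)      ≡⟨ collect L k ⟩
    L * (12 * k)                     ∎
  where
    open ≤-Reasoning
    expand : ∀ t L j → t * (4 * L + j * (4 * L)) ≡ 4 * L * t + 4 * L * (j * t)
    expand = solve-∀
    collect : ∀ L k → 4 * L * k + 4 * L * (k + k) ≡ L * (12 * k)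
    collect = solve-∀
    double : ∀ k L j → (k + (L + L) * (j * j)) + (k + (L + L) * (j * j)) ≡ (k + k) + j * (4 * L) * j
    double = solve-∀
    twice-jt : j * t + j * t ≤ (k + k) + j * t
    twice-jt = begin
      j * t + j * t                                       ≤⟨ +-mono-≤ estimate estimate ⟩
      (k + (L + L) * (j * j)) + (k + (L + L) * (j * j))   ≡⟨ double k L j ⟩
      (k + k) + j * (4 * L) * j                            ≤⟨ +-monoʳ-≤ (k + k) (*-monoˡ-≤ j jd≤t) ⟩
      (k + k) + t * j                                      ≡⟨ cong ((k + k) +_) (*-comm t j) ⟩
      (k + k) + j * t                                      ∎
    jt≤2k : j * t ≤ k + k
    jt≤2k = +-cancelʳ-≤ (j * t) (j * t) (k + k) twice-jt

colouring-bound : ∀ {t r k} L → .{{_ : NonZero L}} → t < 2 ^ suc L →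
  ToneColoring (HeapAndStar.graph t r) t k → t * t ≤ L * (12 * k)
colouring-bound {t} {r} {k} L t<2^L+1 f = balance {t} {k} {L} {j} t≤k estimate (m/n*n≤m t d) t<d+jd
  where
    open HeapAndStar t r
    d : ℕ
    d = 4 * L
    instance
      d≢0 : NonZero d
      d≢0 = m*n≢0 4 L
    j : ℕ
    j = t / d
    C : ℕ → Subset k
    C i = col f (vertex (suc i))
    t≤k : t ≤ k
    t≤k = ≤-trans (≤-reflexive (sym (size f (vertex 1)))) (∣p∣≤n (col f (vertex 1)))
    overlaps : ∀ i i′ → i < j → i′ < j → i ≢ i′ → ∣ C i ∩ C i′ ∣ ≤ L + L
    overlaps i i′ i<j i′<j i≢i′ = shared≤distance f distinct
        (tree-distance {L} t<2^L+1 (s≤s z≤n) i<t (s≤s z≤n) i′<t)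
      where
        i<t : i < t
        i<t = ≤-trans i<j (m/n≤m t d)
        i′<t : i′ < t
        i′<t = ≤-trans i′<j (m/n≤m t d)
        distinct : vertex (suc i) ≢ vertex (suc i′)
        distinct same = i≢i′ (suc-injective (trans (sym (toℕ-vertex (tree-vertex<order i<t)))
                                                   (trans (cong toℕ same) (toℕ-vertex (tree-vertex<order i′<t)))))
    estimate : j * t ≤ k + (L + L) * (j * j)
    estimate = ≤-trans (union-estimate C (λ i → size f (vertex (suc i))) j overlaps)
                       (+-monoˡ-≤ ((L + L) * (j * j)) (∣p∣≤n (⋃< C j)))
    t<d+jd : t < d + j * d
    t<d+jd = ≤-trans (s≤s (≤-reflexive (m≡m%n+[m/n]*n t d))) (+-monoˡ-≤ (j * d) (m%n<n t d))

dyadic-range : ∀ b x → 1 ≤ x → x < 2 ^ b → ∃[ L ] (2 ^ L ≤ x × x < 2 ^ suc L)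
dyadic-range zero    x 1≤x x<1 = contradiction (≤-trans x<1 1≤x) (n≮n x)
dyadic-range (suc b) x 1≤x x<2^b+1 with x <? 2 ^ b
... | yes x<2^b = dyadic-range b x 1≤x x<2^b
... | no x≮2^b  = b , ≮⇒≥ x≮2^b , x<2^b+1

n<2^n : ∀ n → n < 2 ^ n
n<2^n zero    = s≤s z≤n
n<2^n (suc n) = ≤-trans (≤-reflexive (+-comm 1 (suc n))) (+-mono-≤ (n<2^n n) (≤-trans (m^n>0 2 n) (m≤m+n _ 0)))

exponentiate : ∀ {t L} q k → 2 ^ L ≤ t → t * t ≤ L * (q * k) → 2 ^ (1 * (t * t)) ≤ t ^ (q * k)
exponentiate {t} {L} q k 2^L≤t t²≤Lqk = begin
    2 ^ (1 * (t * t))   ≤⟨ ^-monoʳ-≤ 2 (≤-trans (≤-reflexive (*-identityˡ (t * t))) t²≤Lqk) ⟩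
    2 ^ (L * (q * k))   ≡⟨ ^-*-assoc 2 L (q * k) ⟨
    (2 ^ L) ^ (q * k)   ≤⟨ ^-monoˡ-≤ (q * k) 2^L≤t ⟩
    t ^ (q * k)         ∎
  where open ≤-Reasoning

tone-bound : ∀ t r k → 2 ≤ t → ToneColoring (HeapAndStar.graph t r) t k → 2 ^ (1 * (t * t)) ≤ t ^ (12 * k)
tone-bound t r k 2≤t f with dyadic-range t t (≤-trans (s≤s z≤n) 2≤t) (n<2^n t)
... | zero  , _      , t<2   = contradiction (≤-trans t<2 2≤t) (n≮n t)
... | suc ℓ , 2^L≤t , t<2^L+1 = exponentiate {t} {suc ℓ} 12 k 2^L≤t (colouring-bound (suc ℓ) t<2^L+1 f)

mainTheorem16 : (r : ℕ) → 3 ≤ r →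
    ∃[ p ] ∃[ q ] (1 ≤ p × 1 ≤ q ×
      ((t : ℕ) → 2 ≤ t →
        ∃[ G ] (MaxDegreeIs G r ×
          ((k : ℕ) → ToneColoring G t k → 2 ^ (p * (t * t)) ≤ t ^ (q * k)))))
mainTheorem16 r 3≤r =
  1 , 12 , s≤s z≤n , s≤s z≤n ,
  λ t 2≤t → HeapAndStar.graph t r , HeapAndStar.max-degree t r 3≤r , λ k → tone-bound t r k 2≤t
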